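{- (Generalized Parallel Play Lemma.) Let $\mathcal{A}$ and $\mathcal{B}$ be two sets of pebbled $\tau$-structures (all pebbled with the same set of colors), let $r \in \mathbb{N}$, and let $P \in \{\exists,\forall\}^r$. Suppose $\mathcal{A} = \mathcal{A}_1 \sqcup \cdots \sqcup \mathcal{A}_k$ and $\mathcal{B} = \mathcal{B}_1 \sqcup \cdots \sqcup \mathcal{B}_k$, and that for each $1 \le i \le k$ Spoiler has a winning strategy $\mathcal{S}_i$ for the $r_i$-round multi-structural game on $(\mathcal{A}_i, \mathcal{B}_i)$, where $r_i \le r$, such that: (1) for every $i$, $\mathsf{pat}(\mathcal{S}_i)$ is a subsequence of $P$; (2) at the end of the sub-games, for $i \neq j$ there is no board arising from $\mathcal{A}_i$ and board arising from $\mathcal{B}_j$ forming a matching pair. Then Spoiler wins the $r$-round multi-structural game on $(\mathcal{A},\mathcal{B})$ with pattern $P$.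
   Context: Fix a finite vocabulary $\tau$ of relation and constant symbols. A pebbled structure $\langle \mathbf{A} \mid a_1, \ldots, a_k\rangle$ is a $\tau$-structure $\mathbf{A}$ together with pebbles of distinct colors placed on elements $a_1,\dots,a_k$ (not necessarily distinct); it is also called a board. Two pebbled structures $\langle \mathbf{A} \mid a_1, \ldots, a_k\rangle$ and $\langle \mathbf{B} \mid b_1, \ldots, b_k\rangle$ (same colors) form a matching pair if the map $a_i \mapsto b_i$, $c^{\mathbf{A}} \mapsto c^{\mathbf{B}}$ (for constant symbols $c$) is a well-defined isomorphism between the induced substructures. The $r$-round multi-structural (MS) game on $(\mathcal{A},\mathcal{B})$: in each round Spoiler chooses a side and an unused color and places a pebble of that color on an element of every board on the chosen side; Duplicator may make any number of copies of each board on the other side and places a pebble of that color on an element of each. Duplicator wins if after round $r$ some board on side $\mathcal{A}$ and some board on side $\mathcal{B}$ form a matching pair; otherwise Spoiler wins. The pattern $\mathsf{pat}(\mathcal{S})\in\{\exists,\forall\}^r$ of a Spoiler strategy $\mathcal{S}$ records $\exists$ in round $i$ if Spoiler plays on side $\mathcal{A}$ and $\forall$ if he plays on side $\mathcal{B}$ (strategies are considered against Duplicator's strategy of playing all possible responses, so sides are determined by the instance). Spoiler wins with pattern $P$ if he has a winning strategy with pattern $P$. -}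

module Defs where

open import Data.Nat using (ℕ; zero; suc; _<_)
open import Data.Fin using (Fin; zero; suc; toℕ)
open import Data.Vec using (Vec; []; _∷_; lookup)
import Data.Vec as Vec
open import Data.Sum using (_⊎_; inj₁; inj₂)
open import Data.Product using (Σ; _×_; _,_; proj₁; proj₂)
open import Data.Empty using (⊥)
open import Relation.Nullary using (¬_)
open import Relation.Binary.PropositionalEquality using (_≡_)
open import Function.Bundles using (_⇔_)

record Vocab : Set where
  field
    nRel   : ℕ
    arity  : Fin nRel → ℕ
    nConst : ℕ
open Vocab public

-- τ-structures (with nonempty universe, the standard convention;
-- `point` witnesses nonemptiness).
record Structure (τ : Vocab) : Set₁ where
  field
    U     : Set
    rel   : (R : Fin (nRel τ)) → Vec U (arity τ R) → Set
    const : Fin (nConst τ) → U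
    point : U
open Structure public

record Board (τ : Vocab) (C : Set) : Set₁ where
  field
    str : Structure τ
    peb : C → U str
open Board public

pts : ∀ {τ C} (A : Board τ C) → C ⊎ Fin (nConst τ) → U (str A)
pts A (inj₁ c) = peb A c
pts A (inj₂ d) = const (str A) d

-- Matching pair: a_c ↦ b_c, c^A ↦ c^B is a well-defined, injective map
-- preserving and reflecting every relation, i.e. an isomorphism of the
-- induced substructures.
Matching : ∀ {τ C} → Board τ C → Board τ C → Set
Matching {τ} {C} A B =
  ((p q : C ⊎ Fin (nConst τ)) → (pts A p ≡ pts A q) ⇔ (pts B p ≡ pts B q))
  × ((R : Fin (nRel τ)) (ps : Vec (C ⊎ Fin (nConst τ)) (arity τ R)) →
       rel (str A) R (Vec.map (pts A) ps) ⇔ rel (str B) R (Vec.map (pts B) ps))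

recolour : ∀ {τ C D} → (D → C) → Board τ C → Board τ D
recolour f A = record { str = str A ; peb = λ d → peb A (f d) }

-- Colours in a game: c₀ initial colours, plus one colour per round played
-- (the pebble placed in round t, counted from 0, has colour inj₂ t).

Col : ℕ → ℕ → Set
Col c₀ m = Fin c₀ ⊎ Fin m

snoc : ∀ {m} {X : Set} → (Fin m → X) → X → Fin (suc m) → X
snoc {zero}  f x zero    = x
snoc {suc m} f x zero    = f zero
snoc {suc m} f x (suc j) = snoc (λ i → f (suc i)) x j

extend : ∀ {τ c₀ m} (A : Board τ (Col c₀ m)) → U (str A) → Board τ (Col c₀ (suc m))
extend A u = record { str = str A ; peb = p }
  where
  p : _ → _
  p (inj₁ c) = peb A (inj₁ c)
  p (inj₂ j) = snoc (λ i → peb A (inj₂ i)) u j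

-- A position of the MS game: a family of boards on each side
-- (a set of boards is represented as an indexed family).
record State (τ : Vocab) (c₀ m : ℕ) : Set₁ where
  field
    IA : Set
    A  : IA → Board τ (Col c₀ m)
    IB : Set
    B  : IB → Board τ (Col c₀ m)
open State public

-- Spoiler plays on side 𝒜, choosing element f a on each board a; Duplicator
-- answers with all possible responses on every board of side 𝒝
-- (one copy of board b for each element of its universe).
stepA : ∀ {τ c₀ m} (s : State τ c₀ m) → ((a : IA s) → U (str (A s a))) → State τ c₀ (suc m)
stepA s f = record
  { IA = IA s
  ; A  = λ a → extend (A s a) (f a)
  ; IB = Σ (IB s) (λ b → U (str (B s b)))
  ; B  = λ bu → extend (B s (proj₁ bu)) (proj₂ bu)
  }

stepB : ∀ {τ c₀ m} (s : State τ c₀ m) → ((b : IB s) → U (str (B s b))) → State τ c₀ (suc m)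
stepB s g = record
  { IA = Σ (IA s) (λ a → U (str (A s a)))
  ; A  = λ au → extend (A s (proj₁ au)) (proj₂ au)
  ; IB = IB s
  ; B  = λ b → extend (B s b) (g b)
  }

data Quant : Set where
  ∃q ∀q : Quant

-- Spoiler strategies (against Duplicator playing all possible responses)
-- for an r-round game: Strat r m k s is a strategy from position s with
-- m rounds played and k rounds remaining.
data Strat {τ : Vocab} {c₀ : ℕ} (r : ℕ) : (m k : ℕ) → State τ c₀ m → Set₁ where
  end  : {s : State τ c₀ r} → Strat r r 0 s
  ∃mv  : ∀ {m k} {s : State τ c₀ m} (f : (a : IA s) → U (str (A s a))) →
         Strat r (suc m) k (stepA s f) → Strat r m (suc k) s
  ∀mv  : ∀ {m k} {s : State τ c₀ m} (g : (b : IB s) → U (str (B s b))) →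
         Strat r (suc m) k (stepB s g) → Strat r m (suc k) s

pat : ∀ {τ c₀ r m k} {s : State τ c₀ m} → Strat r m k s → Vec Quant k
pat end       = []
pat (∃mv f σ) = ∃q ∷ pat σ
pat (∀mv g σ) = ∀q ∷ pat σ

final : ∀ {τ c₀ r m k} {s : State τ c₀ m} → Strat r m k s → State τ c₀ r
final {s = s} end = s
final (∃mv f σ)   = final σ
final (∀mv g σ)   = final σ

Winning : ∀ {τ c₀ r m k} {s : State τ c₀ m} → Strat r m k s → Set
Winning σ = ¬ Σ (IA (final σ)) (λ a → Σ (IB (final σ)) (λ b →
              Matching (A (final σ) a) (B (final σ) b)))

SpoilerWinsWith : ∀ {τ c₀} (r : ℕ) → Vec Quant r → State τ c₀ 0 → Set₁
SpoilerWinsWith r P s = Σ (Strat r 0 r s) (λ σ → (pat σ ≡ P) × Winning σ)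

IsSubseqVia : ∀ {p r} {X : Set} → (Fin p → Fin r) → Vec X p → Vec X r → Set
IsSubseqVia {p} e Q P =
  ((s t : Fin p) → toℕ s < toℕ t → toℕ (e s) < toℕ (e t))
  × ((t : Fin p) → lookup P (e t) ≡ lookup Q t)

-- Colours shared by a board of sub-game i (rounds embedded by e₁) and a board
-- of sub-game j (rounds embedded by e₂): the initial colours, and pairs of
-- rounds that are played as the same round of the big game.
Common : ∀ {p q r} → ℕ → (Fin p → Fin r) → (Fin q → Fin r) → Set
Common {p} {q} c₀ e₁ e₂ = Fin c₀ ⊎ Σ (Fin p × Fin q) (λ st → e₁ (proj₁ st) ≡ e₂ (proj₂ st))

commonˡ : ∀ {p q r c₀} (e₁ : Fin p → Fin r) (e₂ : Fin q → Fin r) → Common c₀ e₁ e₂ → Col c₀ p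
commonˡ e₁ e₂ (inj₁ c) = inj₁ c
commonˡ e₁ e₂ (inj₂ st) = inj₂ (proj₁ (proj₁ st))

commonʳ : ∀ {p q r c₀} (e₁ : Fin p → Fin r) (e₂ : Fin q → Fin r) → Common c₀ e₁ e₂ → Col c₀ q
commonʳ e₁ e₂ (inj₁ c) = inj₁ c
commonʳ e₁ e₂ (inj₂ st) = inj₂ (proj₂ (proj₁ st))

MatchingAcross : ∀ {τ c₀ p q r} (e₁ : Fin p → Fin r) (e₂ : Fin q → Fin r) →
                 Board τ (Col c₀ p) → Board τ (Col c₀ q) → Set
MatchingAcross e₁ e₂ A B = Matching (recolour (commonˡ e₁ e₂) A) (recolour (commonʳ e₁ e₂) B)

initial : ∀ {τ c₀} (I : Set) → (I → Board τ (Col c₀ 0)) → (J : Set) → (J → Board τ (Col c₀ 0)) → State τ c₀ 0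
initial I A J B = record { IA = I ; A = A ; IB = J ; B = B }

⨆ : ∀ {k} {X : Set₁} (I : Fin k → Set) → ((i : Fin k) → I i → X) → Σ (Fin k) I → X
⨆ I F (i , x) = F i x

{-# OPTIONS --safe #-}
module Submission where

-- Spoiler first pads each Sᵢ to an r-round strategy with pattern exactly P, by
-- playing arbitrary moves in the rounds outside the image of eᵢ.  He then plays
-- the padded strategies simultaneously: on a board coming from 𝒜ᵢ or ℬᵢ he makes
-- the move that the i-th strategy makes on the corresponding board.  Throughout,
-- every board of the combined game is, after recolouring its pebbles along some
-- eᵢ, a board of the i-th sub-game.  A matching pair at the end therefore restricts
-- either to a matching pair inside one sub-game, which Sᵢ excludes, or to a pair
-- matching across two sub-games, which is excluded by hypothesis.

open import Defs
open import Level using (Level; _⊔_) renaming (suc to lsuc; zero to lzero)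
open import Data.Nat using (ℕ; zero; suc; _+_; _≤_; _<_; z≤n; s≤s; s<s⁻¹)
open import Data.Nat.Properties using (+-suc; +-identityʳ)
open import Data.Fin using (Fin; zero; suc; toℕ; inject₁; fromℕ; punchOut; _≟_)
open import Data.Fin.Properties using (toℕ-injective; toℕ-fromℕ; toℕ-inject₁; punchIn-punchOut; 0≢1+n)
open import Data.Vec using (Vec; []; _∷_; lookup)
import Data.Vec as Vec
open import Data.Vec.Properties using (map-cong; map-∘)
open import Data.Sum using (_⊎_; inj₁; inj₂; map₁; map₂)
open import Data.Sum.Properties using (map-map; map₂-cong)
open import Data.Product using (Σ; Σ-syntax; _×_; _,_; proj₁; proj₂; swap)
import Data.Product as Product
open import Data.Unit using (⊤)
open import Function using (_∘_; id)
open import Function.Bundles using (_⇔_)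
open import Relation.Nullary using (¬_; yes; no)
open import Relation.Binary.Definitions using (DecidableEquality)
open import Relation.Binary.PropositionalEquality

board : ∀ {τ C} (S : Structure τ) → (C → U S) → Board τ C
board S p = record { str = S ; peb = p }

-- Pebbles are compared pointwise rather than through recolour g X ≡ Y: without
-- function extensionality, boards reached by different sequences of moves cannot
-- be proved equal.
data Restricts {τ C D} (g : D → C) : Board τ C → Board τ D → Set₁ where
  restricts : ∀ {S p q} → (∀ d → p (g d) ≡ q d) → Restricts g (board S p) (board S q)

module _ {τ : Vocab} {C D : Set} {g : D → C} where

  push : ∀ {X Y} → Restricts {τ} g X Y → U (str X) → U (str Y)
  push (restricts _) u = u

  pull : ∀ {X Y} → Restricts {τ} g X Y → U (str Y) → U (str X)
  pull (restricts _) u = u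

  restricts-recolour : ∀ {X} → Restricts {τ} g X (recolour g X)
  restricts-recolour = restricts (λ _ → refl)

  restricts-cong : ∀ {g′ X Y} → (∀ d → g d ≡ g′ d) → Restricts {τ} g X Y → Restricts g′ X Y
  restricts-cong g≗g′ (restricts {p = p} e) = restricts (λ d → trans (cong p (sym (g≗g′ d))) (e d))

  restricts-∘ : ∀ {E} {g′ : E → D} {X Y Z} →
                Restricts {τ} g X Y → Restricts g′ Y Z → Restricts (g ∘ g′) X Z
  restricts-∘ {g′ = g′} (restricts e) (restricts e′) = restricts (λ d → trans (e (g′ d)) (e′ d))

  private
    conj : ∀ {A A′ B B′ : Set} → A ≡ A′ → B ≡ B′ → A′ ⇔ B′ → A ⇔ B
    conj refl refl A⇔B = A⇔B

    pts-restricts : ∀ {S p q} → (∀ d → p (g d) ≡ q d) →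
                    ∀ z → pts {τ} (board S q) z ≡ pts (board S p) (map₁ g z)
    pts-restricts e (inj₁ d) = sym (e d)
    pts-restricts e (inj₂ c) = refl

    map-pts-restricts : ∀ {S p q n} → (∀ d → p (g d) ≡ q d) → (ps : Vec _ n) →
                        Vec.map (pts {τ} (board S q)) ps ≡
                        Vec.map (pts (board S p)) (Vec.map (map₁ g) ps)
    map-pts-restricts e ps = trans (map-cong (pts-restricts e) ps) (map-∘ _ (map₁ g) ps)

  matching-restrict : ∀ {X X′ Y Y′} → Restricts {τ} g X X′ → Restricts g Y Y′ →
                      Matching X Y → Matching X′ Y′
  matching-restrict (restricts {S} eX) (restricts {T} eY) (same , related) =
    (λ z w → conj (cong₂ _≡_ (pts-restricts eX z) (pts-restricts eX w))
                  (cong₂ _≡_ (pts-restricts eY z) (pts-restricts eY w))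
                  (same (map₁ g z) (map₁ g w))) ,
    (λ R ps → conj (cong (rel S R) (map-pts-restricts eX ps))
                   (cong (rel T R) (map-pts-restricts eY ps))
                   (related R (Vec.map (map₁ g) ps)))

restricts-id : ∀ {τ C D} {X : Board τ (C ⊎ D)} → Restricts (map₂ id) X X
restricts-id = restricts λ { (inj₁ c) → refl ; (inj₂ d) → refl }

matching-across : ∀ {τ c₀ p q r} {e₁ : Fin p → Fin r} {e₂ : Fin q → Fin r} {X Y X′ Y′} →
                  Restricts {τ} (map₂ {A = Fin c₀} e₁) X X′ → Restricts (map₂ e₂) Y Y′ →
                  Matching X Y → MatchingAcross e₁ e₂ X′ Y′
matching-across {e₁ = e₁} {e₂} ρX ρY =
  matching-restrict (restricts-∘ ρX restricts-recolour)
                    (restricts-cong (sym ∘ common-agrees) (restricts-∘ ρY restricts-recolour))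
  where
  common-agrees : ∀ d → map₂ e₁ (commonˡ e₁ e₂ d) ≡ map₂ e₂ (commonʳ e₁ e₂ d)
  common-agrees (inj₁ c)             = refl
  common-agrees (inj₂ (_ , e₁s≡e₂t)) = cong inj₂ e₁s≡e₂t

-- Maps between rounds are tracked through their values in ℕ, where shifting by
-- the number of rounds already played is plain addition.
Follows : ∀ {n m} → (ℕ → ℕ) → (Fin n → Fin m) → Set
Follows F h = ∀ t → toℕ (h t) ≡ F (toℕ t)

extendMap : ∀ {n m} → (Fin n → Fin m) → Fin (suc n) → Fin (suc m)
extendMap {m = m} h = snoc (inject₁ ∘ h) (fromℕ m)

fromℕ-or-inject₁ : ∀ {n} (P : Fin (suc n) → Set) → P (fromℕ n) → (∀ j → P (inject₁ j)) → ∀ t → P t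
fromℕ-or-inject₁ {zero}  P last _   zero    = last
fromℕ-or-inject₁ {suc n} P _    old zero    = old zero
fromℕ-or-inject₁ {suc n} P last old (suc t) = fromℕ-or-inject₁ (P ∘ suc) last (old ∘ suc) t

snoc-fromℕ : ∀ {n} {X : Set} (f : Fin n → X) x → snoc f x (fromℕ n) ≡ x
snoc-fromℕ {zero}  f x = refl
snoc-fromℕ {suc n} f x = snoc-fromℕ (f ∘ suc) x

snoc-inject₁ : ∀ {n} {X : Set} (f : Fin n → X) x j → snoc f x (inject₁ j) ≡ f j
snoc-inject₁ {suc n} f x zero    = refl
snoc-inject₁ {suc n} f x (suc j) = snoc-inject₁ (f ∘ suc) x j

extendMap-fromℕ : ∀ {n m} (h : Fin n → Fin m) → extendMap h (fromℕ n) ≡ fromℕ m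
extendMap-fromℕ h = snoc-fromℕ (inject₁ ∘ h) _

extendMap-inject₁ : ∀ {n m} (h : Fin n → Fin m) j → extendMap h (inject₁ j) ≡ inject₁ (h j)
extendMap-inject₁ h = snoc-inject₁ (inject₁ ∘ h) _

follows-extend : ∀ {n m F} {h : Fin n → Fin m} → Follows F h → F n ≡ m → Follows F (extendMap h)
follows-extend {n} {m} {F} {h} follows Fn≡m = fromℕ-or-inject₁ _
  (begin
    toℕ (extendMap h (fromℕ n)) ≡⟨ cong toℕ (extendMap-fromℕ h) ⟩
    toℕ (fromℕ m)               ≡⟨ toℕ-fromℕ m ⟩
    m                           ≡⟨ sym Fn≡m ⟩
    F n                         ≡⟨ cong F (sym (toℕ-fromℕ n)) ⟩
    F (toℕ (fromℕ n))           ∎)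
  (λ j → begin
    toℕ (extendMap h (inject₁ j)) ≡⟨ cong toℕ (extendMap-inject₁ h j) ⟩
    toℕ (inject₁ (h j))           ≡⟨ toℕ-inject₁ (h j) ⟩
    toℕ (h j)                     ≡⟨ follows j ⟩
    F (toℕ j)                     ≡⟨ cong F (sym (toℕ-inject₁ j)) ⟩
    F (toℕ (inject₁ j))           ∎)
  where open ≡-Reasoning

follows-skip : ∀ {n m F} {h : Fin n → Fin m} → Follows F h → Follows F (inject₁ ∘ h)
follows-skip follows t = trans (toℕ-inject₁ _) (follows t)

infix  4 _⊑_
infixr 5 _∷ʳ_ _∷_

data _⊑_ {A : Set} : ∀ {κ k} → Vec A κ → Vec A k → Set where
  []   : [] ⊑ []
  _∷ʳ_ : ∀ {κ k} {xs : Vec A κ} {ys : Vec A k} y → xs ⊑ ys → xs ⊑ y ∷ ys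
  _∷_  : ∀ {κ k} {xs : Vec A κ} {ys : Vec A k} x → xs ⊑ ys → x ∷ xs ⊑ x ∷ ys

module _ {A : Set} where

  []⊑ : ∀ {k} (ys : Vec A k) → [] ⊑ ys
  []⊑ []       = []
  []⊑ (y ∷ ys) = y ∷ʳ []⊑ ys

  ⊑-refl : ∀ {k} (xs : Vec A k) → xs ⊑ xs
  ⊑-refl []       = []
  ⊑-refl (x ∷ xs) = x ∷ ⊑-refl xs

  -- index w t is the position in ys of entry t of xs.  Past the end of xs it
  -- continues as the identity, so that index (⊑-refl xs) is the identity on ℕ.
  index : ∀ {κ k} {xs : Vec A κ} {ys : Vec A k} → xs ⊑ ys → ℕ → ℕ
  index []       t       = t
  index (y ∷ʳ w) t       = suc (index w t)
  index (x ∷ w)  zero    = zero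
  index (x ∷ w)  (suc t) = suc (index w t)

  index-⊑-refl : ∀ {k} (xs : Vec A k) t → index (⊑-refl xs) t ≡ t
  index-⊑-refl []       t       = refl
  index-⊑-refl (x ∷ xs) zero    = refl
  index-⊑-refl (x ∷ xs) (suc t) = cong suc (index-⊑-refl xs t)

  module _ {κ k : ℕ} {xs : Vec A κ} where

    IsSubseqVia-tail : ∀ {x} {ys : Vec A k} {e : Fin (suc κ) → Fin k} →
                       IsSubseqVia e (x ∷ xs) ys → IsSubseqVia (e ∘ suc) xs ys
    IsSubseqVia-tail (increasing , agrees) =
      (λ s t s<t → increasing (suc s) (suc t) (s≤s s<t)) , agrees ∘ suc

    IsSubseqVia-drop : ∀ {y} {ys : Vec A k} (e : Fin κ → Fin (suc k)) (nonzero : ∀ t → zero ≢ e t) →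
                       IsSubseqVia e xs (y ∷ ys) → IsSubseqVia (λ t → punchOut (nonzero t)) xs ys
    IsSubseqVia-drop {y} {ys} e nonzero (increasing , agrees) =
      (λ s t s<t → s<s⁻¹ (subst₂ (λ i j → toℕ i < toℕ j)
                                 (sym (punchIn-punchOut (nonzero s)))
                                 (sym (punchIn-punchOut (nonzero t)))
                                 (increasing s t s<t))) ,
      (λ t → trans (cong (lookup (y ∷ ys)) (punchIn-punchOut (nonzero t))) (agrees t))

  private
    above-zero : ∀ {k} {i j : Fin (suc k)} → toℕ i < toℕ j → zero ≢ j
    above-zero {j = zero}  ()
    above-zero {j = suc _} _ ()

  ⊑-from-IsSubseqVia : ∀ {κ k} {xs : Vec A κ} {ys : Vec A k} (e : Fin κ → Fin k) →
                       IsSubseqVia e xs ys → Σ[ w ∈ xs ⊑ ys ] (∀ t → index w (toℕ t) ≡ toℕ (e t))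
  ⊑-from-IsSubseqVia {xs = []}     {ys}     e _ = []⊑ ys , λ ()
  ⊑-from-IsSubseqVia {xs = x ∷ xs} {[]}     e _ with () ← e zero
  ⊑-from-IsSubseqVia {xs = x ∷ xs} {y ∷ ys} e sub@(increasing , agrees) with e zero in e₀ | agrees zero
  ... | zero  | refl = let (w , at) = rest in
    x ∷ w , λ { zero    → cong toℕ (sym e₀)
              ; (suc t) → trans (cong suc (at t)) (cong toℕ (punchIn-punchOut (nonzero t))) }
    where
    nonzero : ∀ t → zero ≢ e (suc t)
    nonzero t = above-zero (increasing zero (suc t) (s≤s z≤n))
    rest : Σ[ w ∈ xs ⊑ ys ] (∀ t → index w (toℕ t) ≡ toℕ (punchOut (nonzero t)))
    rest = ⊑-from-IsSubseqVia _ (IsSubseqVia-drop {xs = xs} {y} {ys} (e ∘ suc) nonzero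
                                   (IsSubseqVia-tail {xs = xs} {x} {y ∷ ys} sub))
  ... | suc j | _    = let (w , at) = rest in
    y ∷ʳ w , λ t → trans (cong suc (at t)) (cong toℕ (punchIn-punchOut (nonzero t)))
    where
    nonzero : ∀ t → zero ≢ e t
    nonzero zero    = λ 0≡e₀ → 0≢1+n (trans 0≡e₀ e₀)
    nonzero (suc t) = above-zero (increasing zero (suc t) (s≤s z≤n))
    rest : Σ[ w ∈ x ∷ xs ⊑ ys ] (∀ t → index w (toℕ t) ≡ toℕ (punchOut (nonzero t)))
    rest = ⊑-from-IsSubseqVia _ (IsSubseqVia-drop {xs = x ∷ xs} {y} {ys} e nonzero sub)

module _ {τ : Vocab} {c₀ : ℕ} where

  restricts-extend : ∀ {n m} {h : Fin n → Fin m} {S : Structure τ} {p q} →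
                     (∀ d → p (map₂ h d) ≡ q d) → ∀ u →
                     Restricts (map₂ {A = Fin c₀} (extendMap h))
                               (extend (board S p) u) (extend (board S q) u)
  restricts-extend {n} {m} {h} {p = p} {q} e u = restricts λ
    { (inj₁ c) → e (inj₁ c)
    ; (inj₂ t) →
        fromℕ-or-inject₁ (λ t → snoc (p ∘ inj₂) u (extendMap h t) ≡ snoc (q ∘ inj₂) u t)
        (begin
          snoc (p ∘ inj₂) u (extendMap h (fromℕ n)) ≡⟨ cong (snoc (p ∘ inj₂) u) (extendMap-fromℕ h) ⟩
          snoc (p ∘ inj₂) u (fromℕ m)               ≡⟨ snoc-fromℕ (p ∘ inj₂) u ⟩
          u                                         ≡⟨ sym (snoc-fromℕ (q ∘ inj₂) u) ⟩
          snoc (q ∘ inj₂) u (fromℕ n)               ∎)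
        (λ j → begin
          snoc (p ∘ inj₂) u (extendMap h (inject₁ j)) ≡⟨ cong (snoc (p ∘ inj₂) u) (extendMap-inject₁ h j) ⟩
          snoc (p ∘ inj₂) u (inject₁ (h j))           ≡⟨ snoc-inject₁ (p ∘ inj₂) u (h j) ⟩
          p (inj₂ (h j))                              ≡⟨ e (inj₂ j) ⟩
          q (inj₂ j)                                  ≡⟨ sym (snoc-inject₁ (q ∘ inj₂) u j) ⟩
          snoc (q ∘ inj₂) u (inject₁ j)               ∎)
        t
    }
    where open ≡-Reasoning

  module _ {n m} {h : Fin n → Fin m} {X : Board τ (Col c₀ m)} {Y : Board τ (Col c₀ n)} where

    restricts-extend-pull : (ρ : Restricts (map₂ h) X Y) (u : U (str Y)) →
                            Restricts (map₂ (extendMap h)) (extend X (pull ρ u)) (extend Y u)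
    restricts-extend-pull (restricts e) = restricts-extend e

    restricts-extend-push : (ρ : Restricts (map₂ h) X Y) (u : U (str X)) →
                            Restricts (map₂ (extendMap h)) (extend X u) (extend Y (push ρ u))
    restricts-extend-push (restricts e) = restricts-extend e

    restricts-skip : Restricts (map₂ h) X Y → (u : U (str X)) →
                     Restricts (map₂ (inject₁ ∘ h)) (extend X u) Y
    restricts-skip (restricts {p = p} e) u = restricts λ
      { (inj₁ c) → e (inj₁ c)
      ; (inj₂ t) → trans (snoc-inject₁ (p ∘ inj₂) u (h t)) (e (inj₂ t))
      }

  Covers : ∀ {I : Set} {n : I → ℕ} {m} →
           (∀ i → Fin (n i) → Fin m) → State τ c₀ m → (∀ i → State τ c₀ (n i)) → Set₁
  Covers {I} h s ss =
    (∀ a → Σ[ i ∈ I ] Σ[ a′ ∈ IA (ss i) ] Restricts (map₂ (h i)) (A s a) (A (ss i) a′)) ×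
    (∀ b → Σ[ i ∈ I ] Σ[ b′ ∈ IB (ss i) ] Restricts (map₂ (h i)) (B s b) (B (ss i) b′))

  NoMatchingPair : ∀ {m} → State τ c₀ m → Set
  NoMatchingPair s = ¬ (Σ[ a ∈ IA s ] Σ[ b ∈ IB s ] Matching (A s a) (B s b))

  swapSides : ∀ {m} → State τ c₀ m → State τ c₀ m
  swapSides s = record { IA = IB s ; A = B s ; IB = IA s ; B = A s }

  Moves : ∀ {m} → Quant → State τ c₀ m → Set
  Moves ∃q s = (a : IA s) → U (str (A s a))
  Moves ∀q s = (b : IB s) → U (str (B s b))

  step : ∀ {m} (q : Quant) (s : State τ c₀ m) → Moves q s → State τ c₀ (suc m)
  step ∃q = stepA
  step ∀q = stepB

  arbitraryMove : ∀ {m} (q : Quant) (s : State τ c₀ m) → Moves q s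
  arbitraryMove ∃q s a = point (str (A s a))
  arbitraryMove ∀q s b = point (str (B s b))

  module _ {I : Set} {n : I → ℕ} {m : ℕ} where

    covers-resp : ∀ {h : ∀ i → Fin (n i) → Fin m} {s} {ss ss′ : ∀ i → State τ c₀ (n i)} →
                  (∀ i → ss i ≡ ss′ i) → Covers h s ss → Covers h s ss′
    covers-resp {s = s} ss≡ss′ (covA , covB) =
      (λ a → let (i , ρ) = covA a in
             i , subst (λ z → Σ[ a′ ∈ IA z ] Restricts _ (A s a) (A z a′)) (ss≡ss′ i) ρ) ,
      (λ b → let (i , ρ) = covB b in
             i , subst (λ z → Σ[ b′ ∈ IB z ] Restricts _ (B s b) (B z b′)) (ss≡ss′ i) ρ)

    covers-map-cong : ∀ {h h′ : ∀ i → Fin (n i) → Fin m} {s} {ss : ∀ i → State τ c₀ (n i)} →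
                      (∀ i t → h i t ≡ h′ i t) → Covers h s ss → Covers h′ s ss
    covers-map-cong h≗h′ (covA , covB) =
      (λ a → let (i , a′ , ρ) = covA a in i , a′ , restricts-cong (map₂-cong (h≗h′ i)) ρ) ,
      (λ b → let (i , b′ , ρ) = covB b in i , b′ , restricts-cong (map₂-cong (h≗h′ i)) ρ)

    covers-∘ : ∀ {n′ : I → ℕ} {h : ∀ i → Fin (n i) → Fin m} {h′ : ∀ i → Fin (n′ i) → Fin (n i)} {s}
                 {ss : ∀ i → State τ c₀ (n i)} {us : ∀ i → State τ c₀ (n′ i)} →
               Covers h s ss → (∀ i → Covers (λ _ → h′ i) (ss i) (λ (_ : ⊤) → us i)) →
               Covers (λ i → h i ∘ h′ i) s us
    covers-∘ (covA , covB) cov′ =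
      (λ a → let (i , a′ , ρ) = covA a ; (_ , a″ , ρ′) = proj₁ (cov′ i) a′
             in i , a″ , restricts-cong map-map (restricts-∘ ρ ρ′)) ,
      (λ b → let (i , b′ , ρ) = covB b ; (_ , b″ , ρ′) = proj₂ (cov′ i) b′
             in i , b″ , restricts-cong map-map (restricts-∘ ρ ρ′))

    covers-stepA : ∀ {h : ∀ i → Fin (n i) → Fin m} {s} {ss : ∀ i → State τ c₀ (n i)} →
                   Covers h s ss → (f : ∀ i → Moves ∃q (ss i)) →
                   Σ[ f̃ ∈ Moves ∃q s ]
                     Covers (λ i → extendMap (h i)) (stepA s f̃) (λ i → stepA (ss i) (f i))
    covers-stepA (covA , covB) f =
      (λ a → let (i , a′ , ρ) = covA a in pull ρ (f i a′)) ,
      (λ a → let (i , a′ , ρ) = covA a in i , a′ , restricts-extend-pull ρ (f i a′)) ,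
      (λ (b , u) → let (i , b′ , ρ) = covB b in i , (b′ , push ρ u) , restricts-extend-push ρ u)

    covers-skipA : ∀ {h : ∀ i → Fin (n i) → Fin m} {s} {ss : ∀ i → State τ c₀ (n i)} →
                   Covers h s ss → (f : Moves ∃q s) → Covers (λ i → inject₁ ∘ h i) (stepA s f) ss
    covers-skipA (covA , covB) f =
      (λ a → let (i , a′ , ρ) = covA a in i , a′ , restricts-skip ρ (f a)) ,
      (λ (b , u) → let (i , b′ , ρ) = covB b in i , b′ , restricts-skip ρ u)

    covers-step : ∀ (q : Quant) {h : ∀ i → Fin (n i) → Fin m} {s} {ss : ∀ i → State τ c₀ (n i)} →
                  Covers h s ss → (f : ∀ i → Moves q (ss i)) →
                  Σ[ f̃ ∈ Moves q s ]
                    Covers (λ i → extendMap (h i)) (step q s f̃) (λ i → step q (ss i) (f i))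
    covers-step ∃q cov f = covers-stepA cov f
    covers-step ∀q {s = s} {ss} cov f =
      Product.map₂ swap (covers-stepA {s = swapSides s} {ss = swapSides ∘ ss} (swap cov) f)

    covers-skip : ∀ (q : Quant) {h : ∀ i → Fin (n i) → Fin m} {s} {ss : ∀ i → State τ c₀ (n i)} →
                  Covers h s ss → (f : Moves q s) → Covers (λ i → inject₁ ∘ h i) (step q s f) ss
    covers-skip ∃q cov f = covers-skipA cov f
    covers-skip ∀q {s = s} {ss} cov f =
      swap (covers-skipA {s = swapSides s} {ss = swapSides ∘ ss} (swap cov) f)

    no-matching-pair : ∀ {e : ∀ i → Fin (n i) → Fin m} {s} {ss : ∀ i → State τ c₀ (n i)} →
      DecidableEquality I → Covers e s ss → (∀ i → NoMatchingPair (ss i)) →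
      (∀ i j → i ≢ j → ∀ a b → ¬ MatchingAcross (e i) (e j) (A (ss i) a) (B (ss j) b)) →
      NoMatchingPair s
    no-matching-pair _≟ᵢ_ (covA , covB) none none-across (a , b , M)
      with covA a | covB b
    ... | i , a′ , ρA | j , b′ , ρB with i ≟ᵢ j
    ...   | yes refl = none i (a′ , b′ , matching-restrict ρA ρB M)
    ...   | no i≢j   = none-across i j i≢j a′ b′ (matching-across ρA ρB M)

  record Uncons {ρ m k} {s : State τ c₀ m} (q : Quant) (Q : Vec Quant k)
                (σ : Strat ρ m (suc k) s) : Set₁ where
    field
      first      : Moves q s
      rest       : Strat ρ (suc m) k (step q s first)
      pat-rest   : pat rest ≡ Q
      final-rest : final rest ≡ final σ

  uncons : ∀ {ρ m k} {s : State τ c₀ m} {Q : Vec Quant k} (q : Quant) (σ : Strat ρ m (suc k) s) →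
           pat σ ≡ q ∷ Q → Uncons q Q σ
  uncons ∃q (∃mv f σ) refl = record { first = f ; rest = σ ; pat-rest = refl ; final-rest = refl }
  uncons ∀q (∀mv g σ) refl = record { first = g ; rest = σ ; pat-rest = refl ; final-rest = refl }

  final-end : ∀ {ρ} {s : State τ c₀ ρ} (σ : Strat ρ ρ 0 s) → final σ ≡ s
  final-end end = refl

  module _ (r : ℕ) where

    record Reaching {m k ℓ} (s : State τ c₀ m) (Q : Vec Quant k) (Φ : State τ c₀ r → Set ℓ) :
                    Set (lsuc lzero ⊔ ℓ) where
      constructor reaching
      field
        strategy : Strat r m k s
        has-pat  : pat strategy ≡ Q
        outcome  : Φ (final strategy)

    module _ {m k : ℕ} {ℓ : Level} {s : State τ c₀ m} {Q : Vec Quant k} where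

      reaching-move : ∀ {Φ : State τ c₀ r → Set ℓ} (q : Quant) (f : Moves q s) →
                      Reaching (step q s f) Q Φ → Reaching s (q ∷ Q) Φ
      reaching-move ∃q f (reaching T refl φ) = reaching (∃mv f T) refl φ
      reaching-move ∀q f (reaching T refl φ) = reaching (∀mv f T) refl φ

      reaching-map : ∀ {ℓ′} {Φ : State τ c₀ r → Set ℓ} {Ψ : State τ c₀ r → Set ℓ′} →
                     (∀ {z} → Φ z → Ψ z) → Reaching s Q Φ → Reaching s Q Ψ
      reaching-map Φ⇒Ψ (reaching T pat≡ φ) = reaching T pat≡ (Φ⇒Ψ φ)

    -- Spoiler copies the moves of the strategies σ i, which have played n rounds,
    -- in the rounds that w keeps, and plays arbitrarily in the others.  Their round
    -- t < n was played as round h t; F is the eventual map between rounds, so it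
    -- must send the coming round n + t to m + index w t.
    simulate : ∀ {I : Set} {ρ n κ m k} {ss : I → State τ c₀ n} {s : State τ c₀ m}
                 {xs : Vec Quant κ} {Q : Vec Quant k}
               (σ : ∀ i → Strat ρ n κ (ss i)) → (∀ i → pat (σ i) ≡ xs) → (w : xs ⊑ Q)
               (F : ℕ → ℕ) {h : Fin n → Fin m} → Covers (λ _ → h) s ss → Follows F h →
               (∀ t → F (n + t) ≡ m + index w t) → κ + n ≡ ρ → k + m ≡ r →
               Reaching s Q (λ z → Σ[ H ∈ (Fin ρ → Fin r) ]
                                     Follows F H × Covers (λ _ → H) z (λ i → final (σ i)))
    simulate σ _ [] F {h} cov follows _ refl refl =
      reaching end refl (h , follows , covers-resp (λ i → sym (final-end (σ i))) cov)
    simulate {m = m} {s = s} σ pat≡ (q ∷ʳ w) F cov follows shifted κ+n≡ρ k+m≡r =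
      reaching-move q (arbitraryMove q s)
        (simulate σ pat≡ w F (covers-skip q cov _) (follows-skip {F = F} follows)
           (λ t → trans (shifted t) (+-suc m _)) κ+n≡ρ (trans (+-suc _ m) k+m≡r))
    simulate {n = n} {suc κ} {m} σ pat≡ (q ∷ w) F cov follows shifted κ+n≡ρ k+m≡r =
      let (f̃ , cov′) = covers-step q cov N.first in
      reaching-move q f̃
        (reaching-map (λ (H , follows′ , cov″) → H , follows′ , covers-resp N.final-rest cov″)
          (simulate N.rest N.pat-rest w F cov′ (follows-extend {F = F} follows Fn≡m) shifted′
             (trans (+-suc κ n) κ+n≡ρ) (trans (+-suc _ m) k+m≡r)))
      where
      module N i = Uncons (uncons q (σ i) (pat≡ i))
      Fn≡m : F n ≡ m
      Fn≡m = trans (cong F (sym (+-identityʳ n))) (trans (shifted 0) (+-identityʳ m))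
      shifted′ : ∀ t → F (suc n + t) ≡ suc m + index w t
      shifted′ t = trans (cong F (sym (+-suc n t))) (trans (shifted (suc t)) (+-suc m _))

    pad : ∀ {ρ} {s : State τ c₀ 0} {P : Vec Quant r} (σ : Strat ρ 0 ρ s) (e : Fin ρ → Fin r) →
          IsSubseqVia e (pat σ) P → Reaching s P (λ z → Covers (λ _ → e) z (λ (_ : ⊤) → final σ))
    pad σ e sub =
      let (w , index≡e) = ⊑-from-IsSubseqVia e sub in
      reaching-map (λ (_ , follows , cov) →
                      covers-map-cong (λ _ t → toℕ-injective (trans (follows t) (index≡e t))) cov)
        (simulate (λ _ → σ) (λ _ → refl) w (index w) {id}
           ((λ a → _ , a , restricts-id) , (λ b → _ , b , restricts-id))
           (λ ()) (λ _ → refl) (+-identityʳ _) (+-identityʳ r))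

    parallel : ∀ {I} {ss : I → State τ c₀ 0} {s : State τ c₀ 0} {P : Vec Quant r}
               (T : ∀ i → Strat r 0 r (ss i)) → (∀ i → pat (T i) ≡ P) → Covers (λ _ → id) s ss →
               Reaching s P (λ z → Covers (λ _ → id) z (λ i → final (T i)))
    parallel {P = P} T pat≡ cov =
      reaching-map (λ (_ , follows , cov′) →
                      covers-map-cong (λ _ t → toℕ-injective (trans (follows t) (index-⊑-refl P (toℕ t))))
                                      cov′)
        (simulate T pat≡ (⊑-refl P) (index (⊑-refl P)) cov (λ ()) (λ _ → refl)
                  (+-identityʳ r) (+-identityʳ r))

lemma3p4 : (τ : Vocab) (c₀ r k : ℕ) (P : Vec Quant r)
    (IA IB : Fin k → Set)
    (𝒜 : (i : Fin k) → IA i → Board τ (Col c₀ 0))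
    (ℬ : (i : Fin k) → IB i → Board τ (Col c₀ 0))
    (rs : Fin k → ℕ) → ((i : Fin k) → rs i ≤ r) →
    (S : (i : Fin k) → Strat (rs i) 0 (rs i) (initial (IA i) (𝒜 i) (IB i) (ℬ i))) →
    ((i : Fin k) → Winning (S i)) →
    (e : (i : Fin k) → Fin (rs i) → Fin r) →
    ((i : Fin k) → IsSubseqVia (e i) (pat (S i)) P) →
    ((i j : Fin k) → i ≢ j →
      (a : State.IA (final (S i))) (b : State.IB (final (S j))) →
      ¬ MatchingAcross (e i) (e j) (State.A (final (S i)) a) (State.B (final (S j)) b)) →
    SpoilerWinsWith r P (initial (Σ (Fin k) IA) (⨆ IA 𝒜) (Σ (Fin k) IB) (⨆ IB ℬ))
lemma3p4 τ c₀ r k P IA IB 𝒜 ℬ rs _ S W e sub cross = strategy , has-pat , outcome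
  where
  padded : ∀ i → Reaching r (initial (IA i) (𝒜 i) (IB i) (ℬ i)) P
                             (λ z → Covers (λ _ → e i) z (λ (_ : ⊤) → final (S i)))
  padded i = pad r (S i) (e i) (sub i)
  played : Reaching r (initial (Σ (Fin k) IA) (⨆ IA 𝒜) (Σ (Fin k) IB) (⨆ IB ℬ)) P
                      (λ z → Covers (λ _ → id) z (λ i → final (Reaching.strategy (padded i))))
  played = parallel r (Reaching.strategy ∘ padded) (Reaching.has-pat ∘ padded)
             ((λ (i , a) → i , a , restricts-id) , (λ (i , b) → i , b , restricts-id))
  won : ∀ {z} → Covers (λ _ → id) z (λ i → final (Reaching.strategy (padded i))) → NoMatchingPair z
  won cov = no-matching-pair _≟_ (covers-∘ cov (Reaching.outcome ∘ padded)) W cross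
  open Reaching (reaching-map r won played)
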